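{- There exist graphs $G$ and integers $k$ with $k-1\ge\chi(G)$ for which $\underline{\mathrm{lcs}}(G,k)<\underline{\mathrm{lcs}}(G,k-1)$; that is, $\underline{\mathrm{lcs}}(G,k)$ is not in general monotone non-decreasing in $k$.
   Context: For a graph $G=(V,E)$ and an integer $k\ge\chi(G)$, a proper $k$-colouring is a map $c\colon V\to\{1,\dots,k\}$ with adjacent vertices receiving different colours. A determining set for $(G,c)$ is a set $S\subseteq V$ such that no proper $k$-colouring $c'\neq c$ satisfies $c'(s)=c(s)$ for all $s\in S$; a critical set is an inclusion-minimal determining set. $\mathrm{lcs}(G,c)$ is the maximum size of a critical set for $(G,c)$, and $\underline{\mathrm{lcs}}(G,k)$ is the minimum of $\mathrm{lcs}(G,c)$ over all proper $k$-colourings $c$ of $G$. -}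

module Defs where

open import Data.Nat using (ℕ; _≤_)
open import Data.Fin using (Fin)
open import Data.Fin.Subset using (Subset; _∈_; _⊆_; ∣_∣)
open import Data.Product using (Σ; ∃; _×_)
open import Relation.Binary.PropositionalEquality using (_≡_)
open import Relation.Nullary using (¬_)
open import Level using (0ℓ; suc)

record Graph (n : ℕ) : Set₁ where
  field
    Adj   : Fin n → Fin n → Set
    sym   : ∀ {u v} → Adj u v → Adj v u
    irrefl : ∀ {v} → ¬ Adj v v
open Graph public

Colouring : ℕ → ℕ → Set
Colouring n k = Fin n → Fin k

Proper : ∀ {n k} → Graph n → Colouring n k → Set
Proper G c = ∀ {u v} → Adj G u v → ¬ (c u ≡ c v)

Colourable : ∀ {n} → Graph n → ℕ → Set
Colourable {n} G k = Σ (Colouring n k) (Proper G)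

IsChromaticNumber : ∀ {n} → Graph n → ℕ → Set
IsChromaticNumber G χ = Colourable G χ × (∀ j → Colourable G j → χ ≤ j)

Determining : ∀ {n k} → Graph n → Colouring n k → Subset n → Set
Determining {n} {k} G c S =
  ∀ (c' : Colouring n k) → Proper G c' →
  (∀ s → s ∈ S → c' s ≡ c s) → ∀ v → c' v ≡ c v

Critical : ∀ {n k} → Graph n → Colouring n k → Subset n → Set
Critical G c S =
  Determining G c S × (∀ T → T ⊆ S → Determining G c T → T ≡ S)

IsLcs : ∀ {n k} → Graph n → Colouring n k → ℕ → Set
IsLcs G c m =
  (∃ λ S → Critical G c S × ∣ S ∣ ≡ m) ×
  (∀ S → Critical G c S → ∣ S ∣ ≤ m)

IsLowerLcs : ∀ {n} → Graph n → ℕ → ℕ → Set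
IsLowerLcs {n} G k m =
  (∃ λ (c : Colouring n k) → Proper G c × IsLcs G c m) ×
  (∀ (c : Colouring n k) → Proper G c → ∀ m' → IsLcs G c m' → m ≤ m')

module Submission where

-- The graph is the clique {0,1,2,3} together with a path 4 – 5 – 6, where 4 ~ 1, 2 and 5 ~ 0, 3
-- and 6 ~ 2; its chromatic number is 4. For a fixed colouring, whether S is determining is decided
-- by a backtracking search over colourings, and S is certified critical by that search together
-- with, for each x ∈ S, an explicit colouring showing that S - x is not determining. Critical sets
-- are invariant under permuting colours, and every proper colouring is a relabelling of one that
-- colours the clique by 0, 1, 2, 3, so only k³ colourings need to be examined. This shows that
-- every proper 4-colouring has a critical set of size 5 while 0123010 has none larger, and that
-- every proper 5-colouring has a critical set of size 4 while 0123421 has none larger.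

open import Defs hiding (sym)
open import Data.Nat using (ℕ; suc; _≤_; _<_)
open import Data.Product using (Σ; ∃; _×_)

open import Data.Bool using (if_then_else_)
open import Data.Fin using (Fin; suc; toℕ; inject≤; _↑ˡ_; _≟_)
open import Data.Fin.Patterns using (0F; 1F; 2F; 3F; 4F; 5F; 6F)
open import Data.Fin.Permutation
  using (Permutation; _⟨$⟩ʳ_; _⟨$⟩ˡ_; inverseˡ; inverseʳ; flip; id; _∘ₚ_; transpose)
import Data.Fin.Permutation.Components as Components
open import Data.Fin.Properties using (0≢1+n; all?; any?; suc-injective; injective⇒≤; inject≤-injective)
open import Data.Fin.Subset using (Subset; _∈_; _⊆_; ∣_∣; _-_; ⁅_⁆; inside; outside)
open import Data.Fin.Subset.Properties
  using (_∈?_; ⊆-antisym; x∈p∧x≢y⇒x∈p-y; x∈p⇒p-x⊂p; p─q⊆p; anySubset?)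
open import Data.List using (List; []; _∷_; foldr; allFin)
open import Data.List.Membership.Propositional.Properties using (∈-allFin)
import Data.List.Membership.DecPropositional as DecMembership
open import Data.List.Relation.Unary.All as All using (All; []; _∷_)
open import Data.Maybe using (Maybe; just; nothing; maybe; _<∣>_)
open import Data.Nat using (zero)
import Data.Nat.Properties as ℕ
open import Data.Product using (_,_; proj₁)
open import Data.Product.Properties using (≡-dec)
open import Data.Sum using (_⊎_; inj₁; inj₂; [_,_])
import Data.Sum as Sum
open import Data.Vec using (_∷_; [])
import Data.Vec as Vec
open import Function using (_∘_)
open import Function.Definitions using (Injective)
open import Relation.Binary.Definitions using (Decidable)
open import Relation.Binary.PropositionalEquality
  using (_≡_; _≢_; refl; sym; trans; cong; subst; module ≡-Reasoning)
open import Relation.Nullary using (¬_; Dec; yes; no; does; contradiction)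
open import Relation.Nullary.Decidable
  using (map′; ¬?; _×-dec_; _⊎-dec_; _→-dec_; from-yes; dec-true; dec-false)

module _ {k : ℕ} (π : Permutation k k) where

  relabel-injective : ∀ {x y} → π ⟨$⟩ʳ x ≡ π ⟨$⟩ʳ y → x ≡ y
  relabel-injective eq = trans (sym (inverseˡ π)) (trans (cong (π ⟨$⟩ˡ_) eq) (inverseˡ π))

  module _ {n} {c₁ c₂ : Colouring n k} (c₂≗πc₁ : ∀ v → c₂ v ≡ π ⟨$⟩ʳ c₁ v) where

    relabel-inverse : ∀ v → c₁ v ≡ flip π ⟨$⟩ʳ c₂ v
    relabel-inverse v = trans (sym (inverseˡ π)) (cong (π ⟨$⟩ˡ_) (sym (c₂≗πc₁ v)))

    Proper-relabel : (G : Graph n) → Proper G c₁ → Proper G c₂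
    Proper-relabel G proper {u} {v} adj eq =
      proper adj (relabel-injective (trans (sym (c₂≗πc₁ u)) (trans eq (c₂≗πc₁ v))))

transpose-matchˡ : ∀ {k} (i j : Fin k) → Components.transpose i j i ≡ j
transpose-matchˡ i j rewrite dec-true (i ≟ i) refl = refl

transpose-fixed : ∀ {k} {i j x : Fin k} → x ≢ i → x ≢ j → Components.transpose i j x ≡ x
transpose-fixed {i = i} {j} {x} x≢i x≢j rewrite dec-false (x ≟ i) x≢i | dec-false (x ≟ j) x≢j = refl

relabel-injection : ∀ {m k} (e f : Fin m → Fin k) → Injective _≡_ _≡_ e → Injective _≡_ _≡_ f →
                    ∃ λ (π : Permutation k k) → ∀ i → π ⟨$⟩ʳ e i ≡ f i
-- The permutation for e ∘ suc and f ∘ suc is followed by the transposition of π (e 0) and f 0,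
-- which fixes every f (suc i) because f and π ∘ e are injective.
relabel-injection {zero} e f _ _ = id , λ ()
relabel-injection {suc m} e f e-inj f-inj
  with relabel-injection (e ∘ suc) (f ∘ suc) (suc-injective ∘ e-inj) (suc-injective ∘ f-inj)
... | π , π∘e≗f = π ∘ₚ transpose a (f 0F) , moved
  where
  a : Fin _
  a = π ⟨$⟩ʳ e 0F
  moved : ∀ i → Components.transpose a (f 0F) (π ⟨$⟩ʳ e i) ≡ f i
  moved 0F      = transpose-matchˡ a (f 0F)
  moved (suc i) = trans (cong (Components.transpose a (f 0F)) (π∘e≗f i)) (transpose-fixed f≢a f≢f0)
    where
    f≢a : f (suc i) ≢ a
    f≢a eq = 0≢1+n (sym (e-inj (relabel-injective π (trans (π∘e≗f i) eq))))
    f≢f0 : f (suc i) ≢ f 0F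
    f≢f0 eq = 0≢1+n (sym (f-inj eq))

module _ {n k : ℕ} (G : Graph n) where

  Determining-mono : ∀ {c : Colouring n k} {S T} → S ⊆ T → Determining G c S → Determining G c T
  Determining-mono S⊆T det c′ proper agree = det c′ proper (λ s s∈S → agree s (S⊆T s∈S))

  critical : ∀ {c : Colouring n k} {S} → Determining G c S →
             (∀ {x} → x ∈ S → ¬ Determining G c (S - x)) → Critical G c S
  critical {c} {S} det minimal = det , λ T T⊆S detT → ⊆-antisym T⊆S (S⊆T T⊆S detT)
    where
    S⊆T : ∀ {T} → T ⊆ S → Determining G c T → S ⊆ T
    S⊆T {T} T⊆S detT {x} x∈S with x ∈? T
    ... | yes x∈T = x∈T
    ... | no  x∉T = contradiction (Determining-mono T⊆S-x detT) (minimal x∈S)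
      where
      T⊆S-x : T ⊆ S - x
      T⊆S-x y∈T = x∈p∧x≢y⇒x∈p-y (T⊆S y∈T) λ { refl → x∉T y∈T }

  Critical⇒minimal : ∀ {c : Colouring n k} {S x} → Critical G c S → x ∈ S → ¬ Determining G c (S - x)
  Critical⇒minimal {S = S} {x} (_ , minimal) x∈S det with x∈p⇒p-x⊂p x∈S
  ... | _ , y , y∈S , y∉S-x = y∉S-x (subst (y ∈_) (sym (minimal (S - x) (p─q⊆p S ⁅ x ⁆) det)) y∈S)

  Determining-relabel : ∀ (π : Permutation k k) {c₁ c₂ : Colouring n k} {S} →
                        (∀ v → c₂ v ≡ π ⟨$⟩ʳ c₁ v) → Determining G c₁ S → Determining G c₂ S
  Determining-relabel π {c₁} {c₂} {S} c₂≗πc₁ det c′ proper agree v = begin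
    c′ v                 ≡⟨ inverseʳ π ⟨
    π ⟨$⟩ʳ (π ⟨$⟩ˡ c′ v)  ≡⟨ cong (π ⟨$⟩ʳ_) (det (λ w → π ⟨$⟩ˡ c′ w) proper′ agree′ v) ⟩
    π ⟨$⟩ʳ c₁ v          ≡⟨ c₂≗πc₁ v ⟨
    c₂ v                 ∎
    where
    open ≡-Reasoning
    proper′ : Proper G (λ w → π ⟨$⟩ˡ c′ w)
    proper′ = Proper-relabel (flip π) (λ _ → refl) G proper
    agree′ : ∀ s → s ∈ S → π ⟨$⟩ˡ c′ s ≡ c₁ s
    agree′ s s∈S = sym (trans (relabel-inverse π c₂≗πc₁ s) (cong (π ⟨$⟩ˡ_) (sym (agree s s∈S))))

  Critical-relabel : ∀ (π : Permutation k k) {c₁ c₂ : Colouring n k} {S} →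
                     (∀ v → c₂ v ≡ π ⟨$⟩ʳ c₁ v) → Critical G c₁ S → Critical G c₂ S
  Critical-relabel π c₂≗πc₁ (det , minimal) =
    Determining-relabel π c₂≗πc₁ det ,
    λ T T⊆S detT → minimal T T⊆S (Determining-relabel (flip π) (relabel-inverse π c₂≗πc₁) detT)

  isLowerLcs : ∀ {b} (c : Colouring n k) → Proper G c →
               (∀ S → Critical G c S → ∣ S ∣ ≤ b) →
               (∀ c → Proper G c → ∃ λ S → Critical G c S × b ≤ ∣ S ∣) →
               IsLowerLcs G k b
  isLowerLcs c proper bounded large =
    let S , crit , b≤∣S∣ = large c proper in
    (c , proper , (S , crit , ℕ.≤-antisym (bounded S crit) b≤∣S∣) , bounded) ,
    λ c′ proper′ _ (_ , maximal) →
      let S′ , crit′ , b≤∣S′∣ = large c′ proper′ in ℕ.≤-trans b≤∣S′∣ (maximal S′ crit′)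

module _ {n : ℕ} (G : Graph n) where

  IsClique : ∀ {m} → (Fin m → Fin n) → Set
  IsClique q = ∀ i j → i ≢ j → Adj G (q i) (q j)

  Proper⇒injective-on-clique : ∀ {m k} {q : Fin m → Fin n} {c : Colouring n k} →
                                IsClique q → Proper G c → Injective _≡_ _≡_ (c ∘ q)
  Proper⇒injective-on-clique clique proper {i} {j} eq with i ≟ j
  ... | yes i≡j = i≡j
  ... | no  i≢j = contradiction eq (proper (clique i j i≢j))

  clique≤colours : ∀ {m k} {q : Fin m → Fin n} → IsClique q → Colourable G k → m ≤ k
  clique≤colours clique (c , proper) = injective⇒≤ (Proper⇒injective-on-clique clique proper)

  relabel-clique : ∀ {m k} {q : Fin m → Fin n} (f : Fin m → Fin k) → Injective _≡_ _≡_ f →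
                   IsClique q → ∀ {c} → Proper G c →
                   ∃ λ (π : Permutation k k) → ∀ i → π ⟨$⟩ʳ c (q i) ≡ f i
  relabel-clique f f-inj clique proper =
    relabel-injection _ f (Proper⇒injective-on-clique clique proper) f-inj

allSubset? : ∀ {n} {P : Subset n → Set} → (∀ S → Dec (P S)) → Dec (∀ S → P S)
allSubset? {zero} P? = map′ (λ p → λ { [] → p }) (λ p → p []) (P? [])
allSubset? {suc n} P? =
  map′ (λ (in? , out?) → λ { (inside ∷ S) → in? S ; (outside ∷ S) → out? S })
       (λ p → p ∘ (inside ∷_) , p ∘ (outside ∷_))
       (allSubset? (P? ∘ (inside ∷_)) ×-dec allSubset? (P? ∘ (outside ∷_)))

module Decide {n : ℕ} (G : Graph n) (adj? : Decidable (Adj G)) where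

  module _ {k : ℕ} where

    -- A partial colouring lists the vertices coloured so far, most recent first. An edge is
    -- checked when its later endpoint is coloured, so `Admissible` only looks back.
    PartialColouring : Set
    PartialColouring = List (Fin n × Fin k)

    Agrees : Colouring n k → PartialColouring → Set
    Agrees c = All (λ (u , x) → x ≡ c u)

    Admissible : Colouring n k → Subset n → Fin n → Fin k → PartialColouring → Set
    Admissible c S v x ρ = (v ∈ S → x ≡ c v) × All (λ (u , y) → Adj G u v → y ≢ x) ρ

    Forced : Colouring n k → Subset n → List (Fin n) → PartialColouring → Set
    Forced c S []       ρ = Agrees c ρ
    Forced c S (v ∷ vs) ρ = ∀ x → Admissible c S v x ρ → Forced c S vs ((v , x) ∷ ρ)

    agrees? : ∀ c ρ → Dec (Agrees c ρ)
    agrees? c = All.all? (λ (u , x) → x ≟ c u)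

    admissible? : ∀ c S v x ρ → Dec (Admissible c S v x ρ)
    admissible? c S v x ρ =
      (v ∈? S →-dec x ≟ c v) ×-dec All.all? (λ (u , y) → adj? u v →-dec ¬? (y ≟ x)) ρ

    forced? : ∀ c S vs ρ → Dec (Forced c S vs ρ)
    forced? c S []       ρ = agrees? c ρ
    forced? c S (v ∷ vs) ρ = all? λ x → admissible? c S v x ρ →-dec forced? c S vs ((v , x) ∷ ρ)

    Forced⇒Determining : ∀ {c S} → Forced c S (allFin n) [] → Determining G c S
    Forced⇒Determining {c} {S} forced c′ proper agree v =
      All.lookup (proj₁ (extend (allFin n) [] [] forced)) (∈-allFin v)
      where
      admissible : ∀ v ρ → Agrees c′ ρ → Admissible c S v (c′ v) ρ
      admissible v ρ ρ≡c′ =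
        agree v , All.map (λ y≡c′u adj y≡c′v → proper adj (trans (sym y≡c′u) y≡c′v)) ρ≡c′
      extend : ∀ vs ρ → Agrees c′ ρ → Forced c S vs ρ → All (λ v → c′ v ≡ c v) vs × Agrees c ρ
      extend []       ρ _     ρ≡c    = [] , ρ≡c
      extend (v ∷ vs) ρ ρ≡c′ forced
        with extend vs _ (refl ∷ ρ≡c′) (forced (c′ v) (admissible v ρ ρ≡c′))
      ... | vs≡ , (c′v≡cv ∷ ρ≡c) = c′v≡cv ∷ vs≡ , ρ≡c

    proper? : ∀ (c : Colouring n k) → Dec (Proper G c)
    proper? c = map′ (λ p {u} {v} → p u v) (λ p u v → p {u} {v})
                     (all? λ u → all? λ v → adj? u v →-dec ¬? (c u ≟ c v))

    Refutes : Colouring n k → Subset n → Colouring n k → Set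
    Refutes c S c′ = Proper G c′ × (∀ s → s ∈ S → c′ s ≡ c s) × ∃ λ v → c′ v ≢ c v

    refutes? : ∀ c S c′ → Dec (Refutes c S c′)
    refutes? c S c′ =
      proper? c′ ×-dec (all? λ s → s ∈? S →-dec c′ s ≟ c s) ×-dec any? λ v → ¬? (c′ v ≟ c v)

    Refutes⇒¬Determining : ∀ {c S c′} → Refutes c S c′ → ¬ Determining G c S
    Refutes⇒¬Determining (proper , agree , v , c′v≢cv) det = c′v≢cv (det _ proper agree v)

    -- The search is not verified: its result is only used through `refutes?`.
    counterexample : Colouring n k → Subset n → List (Fin n) → PartialColouring → Maybe PartialColouring
    counterexample c S []       ρ = if does (agrees? c ρ) then nothing else just ρ
    counterexample c S (v ∷ vs) ρ = foldr (λ x found → try x <∣> found) nothing (allFin k)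
      where
      try : Fin k → Maybe PartialColouring
      try x = if does (admissible? c S v x ρ) then counterexample c S vs ((v , x) ∷ ρ) else nothing

    complete : Colouring n k → PartialColouring → Colouring n k
    complete c []             v = c v
    complete c ((u , x) ∷ ρ) v = if does (u ≟ v) then x else complete c ρ v

    candidate : Colouring n k → Subset n → Colouring n k
    candidate c S = maybe (complete c) c (counterexample c S (allFin n) [])

    CriticalCertificate : Colouring n k → Subset n → Set
    CriticalCertificate c S =
      Forced c S (allFin n) [] × (∀ x → x ∈ S → Refutes c (S - x) (candidate c (S - x)))

    criticalCertificate? : ∀ c S → Dec (CriticalCertificate c S)
    criticalCertificate? c S =
      forced? c S (allFin n) [] ×-dec all? λ x → x ∈? S →-dec refutes? c (S - x) (candidate c (S - x))

    Certificate⇒Critical : ∀ {c S} → CriticalCertificate c S → Critical G c S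
    Certificate⇒Critical (forced , refuted) =
      critical G (Forced⇒Determining forced) (λ x∈S → Refutes⇒¬Determining (refuted _ x∈S))

    SmallOrNotCritical : Colouring n k → ℕ → Subset n → Set
    SmallOrNotCritical c b S =
      ∣ S ∣ ≤ b ⊎ Refutes c S (candidate c S) ⊎ ∃ λ x → x ∈ S × Forced c (S - x) (allFin n) []

    smallOrNotCritical? : ∀ c b S → Dec (SmallOrNotCritical c b S)
    smallOrNotCritical? c b S =
      ∣ S ∣ ℕ.≤? b ⊎-dec refutes? c S (candidate c S) ⊎-dec
      any? λ x → x ∈? S ×-dec forced? c (S - x) (allFin n) []

    -- c, b and S are explicit: inferring them at the use sites would make Agda normalise the
    -- computed certificates during unification.
    SmallOrNotCritical⇒bounded : ∀ c b S → SmallOrNotCritical c b S → Critical G c S → ∣ S ∣ ≤ b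
    SmallOrNotCritical⇒bounded c b S (inj₁ small) _ = small
    SmallOrNotCritical⇒bounded c b S (inj₂ (inj₁ refutation)) (det , _) =
      contradiction det (Refutes⇒¬Determining refutation)
    SmallOrNotCritical⇒bounded c b S (inj₂ (inj₂ (x , x∈S , forced))) crit =
      contradiction (Forced⇒Determining forced) (Critical⇒minimal G crit x∈S)

edges : List (ℕ × ℕ)
edges = (0 , 1) ∷ (0 , 2) ∷ (0 , 3) ∷ (0 , 5) ∷ (1 , 2) ∷ (1 , 3) ∷ (1 , 4) ∷
        (2 , 3) ∷ (2 , 4) ∷ (2 , 6) ∷ (3 , 5) ∷ (4 , 5) ∷ (5 , 6) ∷ []

open DecMembership (≡-dec ℕ._≟_ ℕ._≟_) using () renaming (_∈_ to _∈ₗ_; _∈?_ to _∈ₗ?_)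

Edge : Fin 7 → Fin 7 → Set
Edge u v = (toℕ u , toℕ v) ∈ₗ edges

edge? : Decidable Edge
edge? u v = (toℕ u , toℕ v) ∈ₗ? edges

loopless : ∀ v → ¬ Edge v v
loopless = from-yes (all? λ v → ¬? (edge? v v))

G : Graph 7
G = record
  { Adj    = λ u v → Edge u v ⊎ Edge v u
  ; sym    = Sum.swap
  ; irrefl = λ {v} → [ loopless v , loopless v ]
  }

adj? : Decidable (Adj G)
adj? u v = edge? u v ⊎-dec edge? v u

open Decide G adj?

clique : Fin 4 → Fin 7
clique = _↑ˡ 3

clique-isClique : IsClique G clique
clique-isClique = from-yes (all? λ i → all? λ j → ¬? (i ≟ j) →-dec adj? (clique i) (clique j))

colouring₄ : Colouring 7 4
colouring₄ = Vec.lookup (0F ∷ 1F ∷ 2F ∷ 3F ∷ 0F ∷ 1F ∷ 0F ∷ [])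

colouring₅ : Colouring 7 5
colouring₅ = Vec.lookup (0F ∷ 1F ∷ 2F ∷ 3F ∷ 4F ∷ 2F ∷ 1F ∷ [])

chromatic : IsChromaticNumber G 4
chromatic = (colouring₄ , from-yes (proper? colouring₄)) , λ _ → clique≤colours G clique-isClique

module Normalised {k : ℕ} (4≤k : 4 ≤ k) where

  base : Fin 4 → Fin k
  base i = inject≤ i 4≤k

  normal : Fin k → Fin k → Fin k → Colouring 7 k
  normal x y z = Vec.lookup (base 0F ∷ base 1F ∷ base 2F ∷ base 3F ∷ x ∷ y ∷ z ∷ [])

  NormalLowerBound : ℕ → Set
  NormalLowerBound b =
    ∀ x y z → Proper G (normal x y z) → ∃ λ S → b ≤ ∣ S ∣ × CriticalCertificate (normal x y z) S

  normalLowerBound? : ∀ b → Dec (NormalLowerBound b)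
  normalLowerBound? b = all? λ x → all? λ y → all? λ z →
    proper? (normal x y z) →-dec
    anySubset? λ S → b ℕ.≤? ∣ S ∣ ×-dec criticalCertificate? (normal x y z) S

  normal≗relabel : ∀ {c : Colouring 7 k} (π : Permutation k k) →
                   (∀ i → π ⟨$⟩ʳ c (clique i) ≡ base i) →
                   ∀ v → normal (π ⟨$⟩ʳ c 4F) (π ⟨$⟩ʳ c 5F) (π ⟨$⟩ʳ c 6F) v ≡ π ⟨$⟩ʳ c v
  normal≗relabel π π∘c∘clique≗base 0F = sym (π∘c∘clique≗base 0F)
  normal≗relabel π π∘c∘clique≗base 1F = sym (π∘c∘clique≗base 1F)
  normal≗relabel π π∘c∘clique≗base 2F = sym (π∘c∘clique≗base 2F)
  normal≗relabel π π∘c∘clique≗base 3F = sym (π∘c∘clique≗base 3F)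
  normal≗relabel π π∘c∘clique≗base 4F = refl
  normal≗relabel π π∘c∘clique≗base 5F = refl
  normal≗relabel π π∘c∘clique≗base 6F = refl

  largeCritical : ∀ {b} → NormalLowerBound b → ∀ c → Proper G c → ∃ λ S → Critical G c S × b ≤ ∣ S ∣
  largeCritical bound c proper
    with relabel-clique G base (inject≤-injective _ _ _ _) clique-isClique proper
  ... | π , π∘c∘clique≗base =
    let c′≗πc = normal≗relabel {c} π π∘c∘clique≗base
        S , b≤∣S∣ , certificate = bound _ _ _ (Proper-relabel π c′≗πc G proper)
        critical′ = Certificate⇒Critical certificate
    in S , Critical-relabel G (flip π) (relabel-inverse π c′≗πc) critical′ , b≤∣S∣

largeCritical₄ : ∀ c → Proper G c → ∃ λ S → Critical G c S × 5 ≤ ∣ S ∣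
largeCritical₄ = Normalised.largeCritical ℕ.≤-refl (from-yes (Normalised.normalLowerBound? ℕ.≤-refl 5))

largeCritical₅ : ∀ c → Proper G c → ∃ λ S → Critical G c S × 4 ≤ ∣ S ∣
largeCritical₅ =
  Normalised.largeCritical (ℕ.n≤1+n 4) (from-yes (Normalised.normalLowerBound? (ℕ.n≤1+n 4) 4))

smallOrNotCritical₄ : ∀ S → SmallOrNotCritical colouring₄ 5 S
smallOrNotCritical₄ = from-yes (allSubset? (smallOrNotCritical? colouring₄ 5))

smallOrNotCritical₅ : ∀ S → SmallOrNotCritical colouring₅ 4 S
smallOrNotCritical₅ = from-yes (allSubset? (smallOrNotCritical? colouring₅ 4))

lowerLcs₄ : IsLowerLcs G 4 5
lowerLcs₄ = isLowerLcs G colouring₄ (from-yes (proper? colouring₄))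
  (λ S → SmallOrNotCritical⇒bounded colouring₄ 5 S (smallOrNotCritical₄ S)) largeCritical₄

lowerLcs₅ : IsLowerLcs G 5 4
lowerLcs₅ = isLowerLcs G colouring₅ (from-yes (proper? colouring₅))
  (λ S → SmallOrNotCritical⇒bounded colouring₅ 4 S (smallOrNotCritical₅ S)) largeCritical₅

mainTheorem12 : Σ ℕ λ n → Σ (Graph n) λ G → Σ ℕ λ k → Σ ℕ λ χ → Σ ℕ λ a → Σ ℕ λ b →
    IsChromaticNumber G χ × χ ≤ k × IsLowerLcs G (suc k) a × IsLowerLcs G k b × a < b
mainTheorem12 = 7 , G , 4 , 4 , 4 , 5 , chromatic , ℕ.≤-refl , lowerLcs₅ , lowerLcs₄ , ℕ.n<1+n 4
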